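{- Let $\Sigma$ be a set of exclusion atoms and $x|y$ an exclusion atom. If $\Sigma\vdash x|y$ (derivability using the rules E1–E6), then $\Sigma\models x|y$.
   Context: Fix a set $\mathcal{V}$ of variables and a set $M$ of values. An assignment is a function $s:\mathcal{V}\to M$; a team is a finite set of assignments. Variables are written $x_i,y_i,\dots$; finite tuples of variables (repetitions allowed) are written $x,y,u,v,\dots$. For a tuple $x=\langle x_1,\dots,x_n\rangle$, $s(x)=\langle s(x_1),\dots,s(x_n)\rangle$, $|x|=n$ is its length, and juxtaposition $xy$ denotes concatenation of tuples. An exclusion atom is an expression $x|y$ with $|x|=|y|$; a team $T$ satisfies it, $T\models x|y$, iff for all $s_1,s_2\in T$, $s_1(x)\neq s_2(y)$. For a set $\Sigma$ of exclusion atoms, $\Sigma\models x|y$ means every team satisfying all atoms of $\Sigma$ satisfies $x|y$. The rules (schemata over all tuples of variables making the atoms well formed) are: (E1) $x|x\vdash y|z$; (E2) $x|y\vdash y|x$; (E3) $x|y\vdash xu|yv$; (E4) $xuu|yvv\vdash xu|yv$; (E5) $xyz|uvw\vdash xzy|uwv$ where $|x|=|u|$ and $|y|=|v|$; (E6) $xw|yw\vdash zz|xy$. $\Sigma\vdash x|y$ means $x|y$ is obtained from atoms of $\Sigma$ by a finite sequence of applications of these rules. -}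

module Defs where

open import Data.Nat using (ℕ; _+_)
open import Data.Vec using (Vec; _++_; map)
open import Data.List using (List)
open import Data.List.Membership.Propositional using (_∈_)
open import Data.Product using (Σ; _×_; _,_)
open import Relation.Binary.PropositionalEquality using (_≢_)

module Exclusion (V M : Set) where

  Tuple : ℕ → Set
  Tuple n = Vec V n

  record Atom : Set where
    constructor _∣_
    field
      {len} : ℕ
      lhs   : Tuple len
      rhs   : Tuple len

  Assignment : Set
  Assignment = V → M

  -- a team is a finite set of assignments, represented by a list
  Team : Set
  Team = List Assignment

  ev : ∀ {n} → Assignment → Tuple n → Vec M n
  ev s x = map s x

  _⊨_ : Team → Atom → Set
  T ⊨ (x ∣ y) = ∀ s₁ s₂ → s₁ ∈ T → s₂ ∈ T → ev s₁ x ≢ ev s₂ y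

  AtomSet : Set₁
  AtomSet = Atom → Set

  _⊨ˢ_ : Team → AtomSet → Set
  T ⊨ˢ Γ = ∀ a → Γ a → T ⊨ a

  _⊫_ : AtomSet → Atom → Set
  Γ ⊫ a = ∀ (T : Team) → T ⊨ˢ Γ → T ⊨ a

  data _⊢_ (Γ : AtomSet) : Atom → Set where
    hyp : ∀ {a} → Γ a → Γ ⊢ a
    E1  : ∀ {n m} {x : Tuple n} {y z : Tuple m} →
          Γ ⊢ (x ∣ x) → Γ ⊢ (y ∣ z)
    E2  : ∀ {n} {x y : Tuple n} →
          Γ ⊢ (x ∣ y) → Γ ⊢ (y ∣ x)
    E3  : ∀ {n k} {x y : Tuple n} {u v : Tuple k} →
          Γ ⊢ (x ∣ y) → Γ ⊢ ((x ++ u) ∣ (y ++ v))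
    E4  : ∀ {n k} {x y : Tuple n} {u v : Tuple k} →
          Γ ⊢ ((x ++ (u ++ u)) ∣ (y ++ (v ++ v))) → Γ ⊢ ((x ++ u) ∣ (y ++ v))
    E5  : ∀ {a b c} {x u : Tuple a} {y v : Tuple b} {z w : Tuple c} →
          Γ ⊢ ((x ++ (y ++ z)) ∣ (u ++ (v ++ w))) →
          Γ ⊢ ((x ++ (z ++ y)) ∣ (u ++ (w ++ v)))
    E6  : ∀ {n k} {x y z : Tuple n} {w : Tuple k} →
          Γ ⊢ ((x ++ w) ∣ (y ++ w)) → Γ ⊢ ((z ++ z) ∣ (x ++ y))

-- A team violates x|y exactly when two of its assignments s₁, s₂ agree in the sense s₁(x) = s₂(y).
-- Each rule reflects such agreements: if s₁, s₂ agree on the conclusion, then a pair drawn from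
-- {s₁, s₂} agrees on the premise, because agreement on a concatenation xu|yv is agreement on
-- x|y together with agreement on u|v.
module Submission where

open import Defs
open import Data.Vec using (_++_)
open import Data.Vec.Properties using (map-++; ++-injective)
open import Data.Product using (_×_; _,_)
open import Relation.Binary.PropositionalEquality using (_≡_; refl; sym; trans; cong₂)

module Soundness (V M : Set) where
  open Exclusion V M

  Agree : Assignment → Assignment → Atom → Set
  Agree s₁ s₂ (x ∣ y) = ev s₁ x ≡ ev s₂ y

  agree-++⁻ : ∀ {n k} s₁ s₂ (x y : Tuple n) (u v : Tuple k) →
              Agree s₁ s₂ ((x ++ u) ∣ (y ++ v)) → Agree s₁ s₂ (x ∣ y) × Agree s₁ s₂ (u ∣ v)
  agree-++⁻ s₁ s₂ x y u v eq =
    ++-injective (ev s₁ x) (ev s₂ y) (trans (sym (map-++ s₁ x u)) (trans eq (map-++ s₂ y v)))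

  agree-++⁺ : ∀ {n k} s₁ s₂ (x y : Tuple n) (u v : Tuple k) →
              Agree s₁ s₂ (x ∣ y) → Agree s₁ s₂ (u ∣ v) → Agree s₁ s₂ ((x ++ u) ∣ (y ++ v))
  agree-++⁺ s₁ s₂ x y u v exy euv =
    trans (map-++ s₁ x u) (trans (cong₂ _++_ exy euv) (sym (map-++ s₂ y v)))

  sound : ∀ {Γ a} → Γ ⊢ a → Γ ⊫ a
  sound {a = a} (hyp γ) T ⊨Γ = ⊨Γ a γ
  sound (E1 d) T ⊨Γ s₁ s₂ s₁∈T s₂∈T _ = sound d T ⊨Γ s₁ s₁ s₁∈T s₁∈T refl
  sound (E2 d) T ⊨Γ s₁ s₂ s₁∈T s₂∈T eq = sound d T ⊨Γ s₂ s₁ s₂∈T s₁∈T (sym eq)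
  sound (E3 {x = x} {y} {u} {v} d) T ⊨Γ s₁ s₂ s₁∈T s₂∈T eq
    with exy , _ ← agree-++⁻ s₁ s₂ x y u v eq
    = sound d T ⊨Γ s₁ s₂ s₁∈T s₂∈T exy
  sound (E4 {x = x} {y} {u} {v} d) T ⊨Γ s₁ s₂ s₁∈T s₂∈T eq
    with exy , euv ← agree-++⁻ s₁ s₂ x y u v eq
    = sound d T ⊨Γ s₁ s₂ s₁∈T s₂∈T
        (agree-++⁺ s₁ s₂ x y (u ++ u) (v ++ v) exy (agree-++⁺ s₁ s₂ u v u v euv euv))
  sound (E5 {x = x} {u} {y} {v} {z} {w} d) T ⊨Γ s₁ s₂ s₁∈T s₂∈T eq
    with exu , e-rest ← agree-++⁻ s₁ s₂ x u (z ++ y) (w ++ v) eq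
    with ezw , eyv ← agree-++⁻ s₁ s₂ z w y v e-rest
    = sound d T ⊨Γ s₁ s₂ s₁∈T s₂∈T
        (agree-++⁺ s₁ s₂ x u (y ++ z) (v ++ w) exu (agree-++⁺ s₁ s₂ y v z w eyv ezw))
  -- s₂(x) = s₁(z) = s₂(y), so s₂ agrees with itself on xw|yw.
  sound (E6 {x = x} {y} {z} {w} d) T ⊨Γ s₁ s₂ s₁∈T s₂∈T eq
    with ezx , ezy ← agree-++⁻ s₁ s₂ z x z y eq
    = sound d T ⊨Γ s₂ s₂ s₂∈T s₂∈T (agree-++⁺ s₂ s₂ x y w w (trans (sym ezx) ezy) refl)

lemma1 : (V M : Set) → let open Exclusion V M in
         (Γ : AtomSet) (a : Atom) → Γ ⊢ a → Γ ⊫ a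
lemma1 V M Γ a = Soundness.sound V M
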